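{- Define $f$ on pairs of a non-negative integer $k$ and a positive integer $\omega$ by $f(0,\omega)=2$ and, for $k\ge 1$, $f(k,\omega)=\omega+(2+5k)\binom{\omega}{2}+f(k-1,\omega)\binom{\omega}{3}$. Then every finite graph $G$ with at least one vertex satisfies $\chi(G)\le f(\mathrm{iocp}(G),\omega(G))$.
   Context: The induced odd cycle packing number $\mathrm{iocp}(G)$ of a graph $G$ is the maximum integer $k$ such that $G$ contains an induced subgraph consisting of $k$ pairwise vertex-disjoint odd cycles (triangles count as odd cycles). $\chi(G)$ is the chromatic number and $\omega(G)$ the clique number of $G$. -}

module Defs where

open import Data.Nat using (ℕ; zero; suc; _+_; _*_; _≤_)
open import Data.Nat.Combinatorics using (_C_)
open import Data.Fin using (Fin; toℕ)
open import Data.Product using (Σ; _×_)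
open import Data.Sum using (_⊎_)
open import Relation.Nullary using (¬_)
open import Relation.Binary using (Decidable)
open import Relation.Binary.PropositionalEquality using (_≡_; _≢_)
open import Function.Bundles using (_⇔_)
open import Function.Definitions using (Injective)

record Graph (n : ℕ) : Set₁ where
  field
    Adj    : Fin n → Fin n → Set
    sym    : ∀ {u v} → Adj u v → Adj v u
    irrefl : ∀ {u} → ¬ Adj u u
    adj?   : Decidable Adj
open Graph public

-- Proper colouring with m colours; χ(G) ≤ m iff G is m-colourable.
Colorable : ∀ {n} → Graph n → ℕ → Set
Colorable {n} G m =
  Σ (Fin n → Fin m) λ c → ∀ u v → Adj G u v → c u ≢ c v

HasClique : ∀ {n} → Graph n → ℕ → Set
HasClique {n} G w =
  Σ (Fin w → Fin n) λ c → Injective _≡_ _≡_ c × (∀ i j → i ≢ j → Adj G (c i) (c j))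

IsCliqueNumber : ∀ {n} → Graph n → ℕ → Set
IsCliqueNumber G w = HasClique G w × (∀ m → HasClique G m → m ≤ w)

oddLen : ℕ → ℕ
oddLen m = 3 + 2 * m

CycNext : ∀ {L} → Fin L → Fin L → Set
CycNext {L} i i' = (suc (toℕ i) ≡ toℕ i') ⊎ (suc (toℕ i) ≡ L × toℕ i' ≡ 0)

CycAdj : ∀ {L} → Fin L → Fin L → Set
CycAdj i i' = CycNext i i' ⊎ CycNext i' i

-- G contains an induced subgraph consisting of k pairwise vertex-disjoint odd cycles.
HasIOCP : ∀ {n} → Graph n → ℕ → Set
HasIOCP {n} G k =
  Σ (Fin k → ℕ) λ len →
  Σ ((j : Fin k) → Fin (oddLen (len j)) → Fin n) λ cyc →
    (∀ j → Injective _≡_ _≡_ (cyc j))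
  × (∀ j j' i i' → j ≢ j' → cyc j i ≢ cyc j' i')
  × (∀ j i i' → Adj G (cyc j i) (cyc j i') ⇔ CycAdj i i')
  × (∀ j j' i i' → j ≢ j' → ¬ Adj G (cyc j i) (cyc j' i'))

IsIOCP : ∀ {n} → Graph n → ℕ → Set
IsIOCP G k = HasIOCP G k × (∀ m → HasIOCP G m → m ≤ k)

f : ℕ → ℕ → ℕ
f zero w = 2
f (suc k) w = w + (2 + 5 * suc k) * (w C 2) + f k w * (w C 3)

module Submission where

-- Take a maximum clique K of size s ≤ ω and classify every vertex x by the set
-- N(x) of its non-neighbours in K, which is non-empty by maximality.  A clique of vertices sharing
-- the same N(x) extends K ∖ N(x) to a clique, so it has at most |N(x)| vertices: the classes with
-- |N(x)| = 1 are independent and those with |N(x)| = 2 are triangle-free.  A class of vertices whose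
-- non-neighbourhoods start with the same triangle T ⊆ K is anticomplete to T, so it packs at most
-- k − 1 induced odd cycles and is f(k − 1, ω)-colourable by induction.  A triangle-free graph packing
-- at most k induced odd cycles is (2 + 5k)-colourable: it is bipartite, or a shortest odd closed walk
-- is an induced cycle C of length at least 5 whose closed neighbourhood is 5-colourable because no
-- walk bypasses an arc of C more cheaply than C itself, and the rest packs at most k − 1 cycles.
-- Counting classes gives ω + (2 + 5k) C(ω,2) + f(k − 1, ω) C(ω,3) colours.

open import Defs renaming (sym to Adj-sym)
open import Data.Empty using (⊥; ⊥-elim)
open import Data.Fin as Fin using (Fin; toℕ)
import Data.Fin.Properties as Fin
open import Data.List using (List; []; _∷_; length; map; _++_; filter; take; lookup)
open import Data.List.Properties using (length-++; length-map; length-take; ≡-dec)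
open import Data.List.Membership.Propositional using (_∈_)
open import Data.List.Membership.Propositional.Properties
  using (∈-++⁺ˡ; ∈-++⁺ʳ; ∈-++⁻; ∈-map⁺; ∈-map⁻; ∈-lookup; ∈-filter⁺; ∈-filter⁻; ∈-length)
open import Data.List.Relation.Binary.Sublist.Propositional
  using ([]; _∷_; _∷ʳ_; ⊆-trans; minimum) renaming (_⊆_ to _⊆ₗ_)
open import Data.List.Relation.Binary.Sublist.Propositional.Properties
  using (All-resp-⊆; Any-resp-⊆; filter-⊆; take-⊆)
open import Data.List.Relation.Unary.All as All using (All; []; _∷_)
import Data.List.Relation.Unary.All.Properties as All
open import Data.List.Relation.Unary.AllPairs using (AllPairs; []; _∷_)
import Data.List.Relation.Unary.AllPairs.Properties as AllPairs
open import Data.List.Relation.Unary.Any using (here; there)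
open import Data.Nat using (ℕ; zero; suc; _+_; _*_; _∸_; _≤_; _<_; z≤n; s≤s; _≤?_; _<?_; parity)
open import Data.Nat.Combinatorics using (_C_; nCk+nC[k+1]≡[n+1]C[k+1]; nC1≡n)
open import Data.Nat.Induction using (<-rec)
open import Data.Nat.Properties
open import Data.Parity.Base using (Parity; 0ℙ; 1ℙ; _⁻¹) renaming (_+_ to _⊕_)
import Data.Parity.Properties as ℙ
open import Data.Product using (Σ; ∃; ∃₂; _×_; _,_; proj₁; proj₂; uncurry)
open import Data.Sum as Sum using (_⊎_; inj₁; inj₂)
open import Function using (_∘_; id; case_of_)
open import Function.Bundles using (_⇔_; mk⇔)
open import Function.Definitions using (Injective)
open import Level using (0ℓ)
open import Relation.Binary.Definitions using (tri<; tri≈; tri>)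
open import Relation.Binary.PropositionalEquality
open import Relation.Nullary using (¬_; Dec; yes; no; ¬?; _×-dec_; contradiction)
open import Relation.Nullary.Decidable using (decidable-stable)
open import Relation.Unary using (Pred; Decidable; _⊆_; _∪_; _∩_; ∁; ∅; U)
open import Relation.Unary.Properties using (_∩?_; _∪?_; ∁?; U?)

Least : Pred ℕ 0ℓ → Set
Least Q = ∃ λ k → Q k × (∀ {j} → j < k → ¬ Q j)

least-witness : ∀ {Q : Pred ℕ 0ℓ} → Decidable Q → ∀ {m} → Q m → Least Q
least-witness {Q} Q? {m} = <-rec (λ m → Q m → Least Q) search m
  where
  search : ∀ m → (∀ {j} → j < m → Q j → Least Q) → Q m → Least Q
  search m smaller qm with anyUpTo? Q? m
  ... | yes (j , j<m , qj) = smaller j<m qj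
  ... | no none = m , qm , λ j<m qj → none (_ , j<m , qj)

odd-summand : ∀ p q → p ⊕ q ≡ 1ℙ → p ≡ 1ℙ ⊎ q ≡ 1ℙ
odd-summand 0ℙ q eq = inj₂ eq
odd-summand 1ℙ q _  = inj₁ refl

bit : Parity → ℕ
bit 0ℙ = 0
bit 1ℙ = 1

bit<2 : ∀ p → bit p < 2
bit<2 0ℙ = s≤s z≤n
bit<2 1ℙ = s≤s (s≤s z≤n)

bit-injective : ∀ {p q} → bit p ≡ bit q → p ≡ q
bit-injective {0ℙ} {0ℙ} _ = refl
bit-injective {1ℙ} {1ℙ} _ = refl

same-parity⇒1+m+n-odd : ∀ m n → parity m ≡ parity n → parity (suc (m + n)) ≡ 1ℙ
same-parity⇒1+m+n-odd m n same = begin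
  parity (1 + (m + n))            ≡⟨ ℙ.+-homo-+ 1 (m + n) ⟩
  1ℙ ⊕ parity (m + n)             ≡⟨ cong (1ℙ ⊕_) (ℙ.+-homo-+ m n) ⟩
  1ℙ ⊕ (parity m ⊕ parity n)      ≡⟨ cong (λ p → 1ℙ ⊕ (p ⊕ parity n)) same ⟩
  1ℙ ⊕ (parity n ⊕ parity n)      ≡⟨ cong (1ℙ ⊕_) (ℙ.p+p≡0ℙ (parity n)) ⟩
  1ℙ                              ∎
  where open ≡-Reasoning

⊕-cancel-middle : ∀ x y z → (x ⊕ z) ⊕ (y ⊕ z) ≡ x ⊕ y
⊕-cancel-middle 0ℙ 0ℙ 0ℙ = refl
⊕-cancel-middle 0ℙ 0ℙ 1ℙ = refl
⊕-cancel-middle 0ℙ 1ℙ 0ℙ = refl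
⊕-cancel-middle 0ℙ 1ℙ 1ℙ = refl
⊕-cancel-middle 1ℙ 0ℙ 0ℙ = refl
⊕-cancel-middle 1ℙ 0ℙ 1ℙ = refl
⊕-cancel-middle 1ℙ 1ℙ 0ℙ = refl
⊕-cancel-middle 1ℙ 1ℙ 1ℙ = refl

parity-+-cancel-middle : ∀ a b c → parity (a + c) ⊕ parity (b + c) ≡ parity (a + b)
parity-+-cancel-middle a b c = begin
  parity (a + c) ⊕ parity (b + c)                  ≡⟨ cong₂ _⊕_ (ℙ.+-homo-+ a c) (ℙ.+-homo-+ b c) ⟩
  (parity a ⊕ parity c) ⊕ (parity b ⊕ parity c)    ≡⟨ ⊕-cancel-middle (parity a) (parity b) (parity c) ⟩
  parity a ⊕ parity b                              ≡⟨ sym (ℙ.+-homo-+ a b) ⟩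
  parity (a + b)                                   ∎
  where open ≡-Reasoning

odd-summands⇒same-parity : ∀ a b c → parity (a + b) ≡ 1ℙ → parity (a + c) ≡ 1ℙ → parity b ≡ parity c
odd-summands⇒same-parity a b c odd-b odd-c = ℙ.+-cancelˡ-≡ (parity a) _ _
  (trans (sym (ℙ.+-homo-+ a b)) (trans odd-b (trans (sym odd-c) (ℙ.+-homo-+ a c))))

infix 4 _≼_
_≼_ : ℕ → ℕ → Set
d ≼ c = d ≤ c × parity d ≡ parity c

≼0 : ∀ {d} → d ≼ 0 → d ≡ 0
≼0 (z≤n , _) = refl

≼1 : ∀ {d} → d ≼ 1 → d ≡ 1
≼1 (s≤s z≤n , _) = refl

≼2 : ∀ {d} → d ≼ 2 → d ≡ 0 ⊎ d ≡ 2
≼2 (z≤n , _)             = inj₁ refl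
≼2 (s≤s (s≤s z≤n) , _)   = inj₂ refl
≼2 (s≤s z≤n , ())

≼3 : ∀ {d} → d ≼ 3 → d ≡ 1 ⊎ d ≡ 3
≼3 (z≤n , ())
≼3 (s≤s z≤n , _)               = inj₁ refl
≼3 (s≤s (s≤s z≤n) , ())
≼3 (s≤s (s≤s (s≤s z≤n)) , _)   = inj₂ refl

odd⇒oddLen : ∀ L → parity L ≡ 1ℙ → L ≢ 1 → ∃ λ m → L ≡ oddLen m
odd⇒oddLen 1 _ L≢1 = contradiction refl L≢1
odd⇒oddLen 3 _ _   = 0 , refl
odd⇒oddLen (suc (suc (suc (suc (suc L))))) odd _ with m , eq ← odd⇒oddLen (3 + L) odd (λ ()) =
  suc m , trans (cong (2 +_) eq) (cong (3 +_) (sym (*-suc 2 m)))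

choose : ∀ {X : Set} → ℕ → List X → List (List X)
choose zero    xs       = [] ∷ []
choose (suc r) []       = []
choose (suc r) (x ∷ xs) = map (x ∷_) (choose r xs) ++ choose (suc r) xs

length-choose : ∀ {X : Set} r (xs : List X) → length (choose r xs) ≡ length xs C r
length-choose zero    xs       = refl
length-choose (suc r) []       = refl
length-choose (suc r) (x ∷ xs) = begin
  length (map (x ∷_) (choose r xs) ++ choose (suc r) xs)
    ≡⟨ length-++ (map (x ∷_) (choose r xs)) ⟩
  length (map (x ∷_) (choose r xs)) + length (choose (suc r) xs)
    ≡⟨ cong₂ _+_ (trans (length-map (x ∷_) (choose r xs)) (length-choose r xs)) (length-choose (suc r) xs) ⟩
  length xs C r + length xs C suc r
    ≡⟨ nCk+nC[k+1]≡[n+1]C[k+1] (length xs) r ⟩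
  suc (length xs) C suc r
    ∎
  where open ≡-Reasoning

∈-choose⁺ : ∀ {X : Set} {c xs : List X} → c ⊆ₗ xs → c ∈ choose (length c) xs
∈-choose⁺ {c = []} _ = here refl
∈-choose⁺ {c = _ ∷ c} (_∷ʳ_ {ys = ys} y τ) = ∈-++⁺ʳ (map (y ∷_) (choose (length c) ys)) (∈-choose⁺ τ)
∈-choose⁺ {c = _ ∷ _} (refl ∷ τ) = ∈-++⁺ˡ (∈-map⁺ _ (∈-choose⁺ τ))

∈-choose⁻ : ∀ {X : Set} r (xs : List X) {c} → c ∈ choose r xs → c ⊆ₗ xs × length c ≡ r
∈-choose⁻ zero    xs       (here refl) = minimum xs , refl
∈-choose⁻ (suc r) (x ∷ xs) c∈ with ∈-++⁻ (map (x ∷_) (choose r xs)) c∈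
... | inj₁ c∈map with ∈-map⁻ (x ∷_) c∈map
...   | c' , c'∈ , refl with ∈-choose⁻ r xs c'∈
...     | τ , eq = refl ∷ τ , cong suc eq
∈-choose⁻ (suc r) (x ∷ xs) c∈ | inj₂ c∈rest with ∈-choose⁻ (suc r) xs c∈rest
... | τ , eq = x ∷ʳ τ , eq

C-monoˡ-≤ : ∀ r {a b} → a ≤ b → a C r ≤ b C r
C-monoˡ-≤ r {b = zero}  z≤n = ≤-refl
C-monoˡ-≤ r {a} {suc b} a≤1+b with m≤n⇒m<n∨m≡n a≤1+b
... | inj₂ refl = ≤-refl
... | inj₁ a<1+b = ≤-trans (C-monoˡ-≤ r (≤-pred a<1+b)) (C-step r b)
  where
  C-step : ∀ r m → m C r ≤ suc m C r
  C-step zero    m = ≤-refl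
  C-step (suc r) m = subst (m C suc r ≤_) (nCk+nC[k+1]≡[n+1]C[k+1] m r) (m≤n+m (m C suc r) (m C r))

choose-count : ∀ {X : Set} (K : List X) {w} a b → length K ≤ w →
               length (choose 1 K) * 1 + (length (choose 2 K) * a + length (choose 3 K) * b)
                 ≤ w + a * (w C 2) + b * (w C 3)
choose-count K {w} a b s≤w = begin
  length (choose 1 K) * 1 + (length (choose 2 K) * a + length (choose 3 K) * b)
    ≡⟨ cong₂ _+_ (trans (*-identityʳ _) (trans (length-choose 1 K) (nC1≡n s)))
                 (cong₂ _+_ (cong (_* a) (length-choose 2 K)) (cong (_* b) (length-choose 3 K))) ⟩
  s + ((s C 2) * a + (s C 3) * b)
    ≤⟨ +-mono-≤ s≤w (+-mono-≤ (*-monoˡ-≤ a (C-monoˡ-≤ 2 s≤w)) (*-monoˡ-≤ b (C-monoˡ-≤ 3 s≤w))) ⟩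
  w + ((w C 2) * a + (w C 3) * b)
    ≡⟨ cong₂ (λ x y → w + (x + y)) (*-comm (w C 2) a) (*-comm (w C 3) b) ⟩
  w + (a * (w C 2) + b * (w C 3))
    ≡⟨ +-assoc w _ _ ⟨
  w + a * (w C 2) + b * (w C 3)
    ∎
  where
  open ≤-Reasoning
  s : ℕ
  s = length K

AllPairs-resp-⊆ₗ : ∀ {X : Set} {R : X → X → Set} {xs ys} → xs ⊆ₗ ys → AllPairs R ys → AllPairs R xs
AllPairs-resp-⊆ₗ []       []       = []
AllPairs-resp-⊆ₗ (y ∷ʳ τ) (_ ∷ rs) = AllPairs-resp-⊆ₗ τ rs
AllPairs-resp-⊆ₗ (refl ∷ τ) (r ∷ rs) = All-resp-⊆ τ r ∷ AllPairs-resp-⊆ₗ τ rs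

AllPairs-lookup : ∀ {X : Set} {R : X → X → Set} → (∀ {x y} → R x y → R y x) →
                  ∀ {xs} → AllPairs R xs → ∀ {i j} → i ≢ j → R (lookup xs i) (lookup xs j)
AllPairs-lookup R-sym (_ ∷ _)   {Fin.zero}  {Fin.zero}  i≢j = contradiction refl i≢j
AllPairs-lookup R-sym (rs ∷ _)  {Fin.zero}  {Fin.suc j} _   = All.lookup rs (∈-lookup j)
AllPairs-lookup R-sym (rs ∷ _)  {Fin.suc i} {Fin.zero}  _   = R-sym (All.lookup rs (∈-lookup i))
AllPairs-lookup R-sym (_ ∷ rss) {Fin.suc i} {Fin.suc j} i≢j = AllPairs-lookup R-sym rss (i≢j ∘ cong Fin.suc)

length-filter-∁ : ∀ {X : Set} {Q : Pred X 0ℓ} (Q? : Decidable Q) xs →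
                  length (filter Q? xs) + length (filter (λ x → ¬? (Q? x)) xs) ≡ length xs
length-filter-∁ Q? []       = refl
length-filter-∁ Q? (x ∷ xs) with Q? x
... | yes _ = cong suc (length-filter-∁ Q? xs)
... | no  _ = trans (+-suc _ _) (cong suc (length-filter-∁ Q? xs))

CycAdj-irrefl : ∀ {L} {i : Fin L} → 1 < L → ¬ CycAdj i i
CycAdj-irrefl {i = i} 1<L = Sum.[ next-irrefl , next-irrefl ]′
  where
  next-irrefl : ¬ CycNext i i
  next-irrefl (inj₁ 1+i≡i)          = 1+n≢n 1+i≡i
  next-irrefl (inj₂ (1+i≡L , i≡0)) = <⇒≢ 1<L (trans (cong suc (sym i≡0)) 1+i≡L)

triangle-consecutive : ∀ (i j : Fin 3) → i ≢ j → CycAdj i j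
triangle-consecutive Fin.zero                     Fin.zero                     i≢j = contradiction refl i≢j
triangle-consecutive Fin.zero                     (Fin.suc Fin.zero)           _   = inj₁ (inj₁ refl)
triangle-consecutive Fin.zero                     (Fin.suc (Fin.suc Fin.zero)) _   = inj₂ (inj₂ (refl , refl))
triangle-consecutive (Fin.suc Fin.zero)           Fin.zero                     _   = inj₂ (inj₁ refl)
triangle-consecutive (Fin.suc Fin.zero)           (Fin.suc Fin.zero)           i≢j = contradiction refl i≢j
triangle-consecutive (Fin.suc Fin.zero)           (Fin.suc (Fin.suc Fin.zero)) _   = inj₁ (inj₁ refl)
triangle-consecutive (Fin.suc (Fin.suc Fin.zero)) Fin.zero                     _   = inj₁ (inj₂ (refl , refl))
triangle-consecutive (Fin.suc (Fin.suc Fin.zero)) (Fin.suc Fin.zero)           _   = inj₂ (inj₁ refl)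
triangle-consecutive (Fin.suc (Fin.suc Fin.zero)) (Fin.suc (Fin.suc Fin.zero)) i≢j = contradiction refl i≢j

module _ {n : ℕ} (G : Graph n) where

  V : Set
  V = Fin n

  VertexSet : Set₁
  VertexSet = Pred V 0ℓ

  infix 4 _~_
  _~_ : V → V → Set
  _~_ = Adj G

  ~-sym : ∀ {x y} → x ~ y → y ~ x
  ~-sym = Adj-sym G

  record Walk (P : VertexSet) (a b : V) (ℓ : ℕ) : Set where
    field
      at     : ℕ → V
      step   : ∀ t → t < ℓ → at t ~ at (suc t)
      inside : ∀ t → t ≤ ℓ → P (at t)
      start  : at 0 ≡ a
      finish : at ℓ ≡ b

  open Walk public

  module _ {P : VertexSet} where

    stay : ∀ {a} → P a → Walk P a a 0
    stay {a} pa = record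
      { at = λ _ → a ; step = λ _ () ; inside = λ _ _ → pa ; start = refl ; finish = refl }

    edge : ∀ {a b} → P a → P b → a ~ b → Walk P a b 1
    edge {a} {b} pa pb a~b = record
      { at = at′ ; step = λ { zero _ → a~b ; (suc _) (s≤s ()) } ; inside = inside′ ; start = refl ; finish = refl }
      where
      at′ : ℕ → V
      at′ zero    = a
      at′ (suc _) = b
      inside′ : ∀ t → t ≤ 1 → P (at′ t)
      inside′ zero    _ = pa
      inside′ (suc _) _ = pb

    first-inside : ∀ {a b ℓ} → Walk P a b ℓ → P a
    first-inside w = subst P (start w) (inside w 0 z≤n)

    infixr 5 _++ʷ_
    _++ʷ_ : ∀ {a b c ℓ₁ ℓ₂} → Walk P a b ℓ₁ → Walk P b c ℓ₂ → Walk P a c (ℓ₁ + ℓ₂)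
    _++ʷ_ {ℓ₁ = ℓ₁} {ℓ₂} w v = record
      { at = join ; step = step′ ; inside = inside′
      ; start = trans (join-left z≤n) (start w)
      ; finish = trans (join-right (m≤m+n ℓ₁ ℓ₂)) (trans (cong (at v) (m+n∸m≡n ℓ₁ ℓ₂)) (finish v)) }
      where
      join : ℕ → V
      join t with t ≤? ℓ₁
      ... | yes _ = at w t
      ... | no  _ = at v (t ∸ ℓ₁)

      join-left : ∀ {t} → t ≤ ℓ₁ → join t ≡ at w t
      join-left {t} t≤ℓ₁ with t ≤? ℓ₁
      ... | yes _   = refl
      ... | no  t≰ℓ₁ = contradiction t≤ℓ₁ t≰ℓ₁

      join-right : ∀ {t} → ℓ₁ ≤ t → join t ≡ at v (t ∸ ℓ₁)
      join-right {t} ℓ₁≤t with t ≤? ℓ₁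
      ... | no  _    = refl
      ... | yes t≤ℓ₁ with refl ← ≤-antisym t≤ℓ₁ ℓ₁≤t =
        trans (finish w) (trans (sym (start v)) (cong (at v) (sym (n∸n≡0 t))))

      step′ : ∀ t → t < ℓ₁ + ℓ₂ → join t ~ join (suc t)
      step′ t t< with ℓ₁ ≤? t
      ... | no  ℓ₁≰t = subst₂ _~_ (sym (join-left (<⇒≤ t<ℓ₁))) (sym (join-left t<ℓ₁)) (step w t t<ℓ₁)
        where
        t<ℓ₁ : t < ℓ₁
        t<ℓ₁ = ≰⇒> ℓ₁≰t
      ... | yes ℓ₁≤t = subst₂ _~_ (sym (join-right ℓ₁≤t))
                         (sym (trans (join-right (m≤n⇒m≤1+n ℓ₁≤t)) (cong (at v) (+-∸-assoc 1 ℓ₁≤t))))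
                         (step v (t ∸ ℓ₁) (subst (_≤ ℓ₂) (+-∸-assoc 1 ℓ₁≤t) (m≤n+o⇒m∸n≤o (suc t) ℓ₁ t<)))

      inside′ : ∀ t → t ≤ ℓ₁ + ℓ₂ → P (join t)
      inside′ t t≤ with ℓ₁ ≤? t
      ... | no  ℓ₁≰t = subst P (sym (join-left (<⇒≤ (≰⇒> ℓ₁≰t)))) (inside w t (<⇒≤ (≰⇒> ℓ₁≰t)))
      ... | yes ℓ₁≤t = subst P (sym (join-right ℓ₁≤t)) (inside v (t ∸ ℓ₁) (m≤n+o⇒m∸n≤o t ℓ₁ t≤))

    reverse : ∀ {a b ℓ} → Walk P a b ℓ → Walk P b a ℓ
    reverse {ℓ = ℓ} w = record
      { at = λ t → at w (ℓ ∸ t)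
      ; step = λ t t<ℓ → ~-sym (subst (λ s → at w (ℓ ∸ suc t) ~ at w s) (sym (+-∸-assoc 1 t<ℓ))
                                  (step w (ℓ ∸ suc t) (subst (_≤ ℓ) (+-∸-assoc 1 t<ℓ) (m∸n≤m ℓ t))))
      ; inside = λ t _ → inside w (ℓ ∸ t) (m∸n≤m ℓ t)
      ; start = finish w
      ; finish = trans (cong (at w) (n∸n≡0 ℓ)) (start w) }

    slice : ∀ {a b ℓ} (w : Walk P a b ℓ) i d → i + d ≤ ℓ → Walk P (at w i) (at w (i + d)) d
    slice w i d i+d≤ℓ = record
      { at = λ t → at w (i + t)
      ; step = λ t t<d → subst (λ s → at w (i + t) ~ at w s) (sym (+-suc i t))
                           (step w (i + t) (≤-trans (≤-reflexive (sym (+-suc i t))) (≤-trans (+-monoʳ-≤ i t<d) i+d≤ℓ)))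
      ; inside = λ t t≤d → inside w (i + t) (≤-trans (+-monoʳ-≤ i t≤d) i+d≤ℓ)
      ; start = cong (at w) (+-identityʳ i)
      ; finish = refl }

    skip-loop : ∀ {a b ℓ i j} (w : Walk P a b ℓ) → i < j → j ≤ ℓ → at w i ≡ at w j → Walk P a b (i + (ℓ ∸ j))
    skip-loop {ℓ = ℓ} {i} {j} w i<j j≤ℓ same =
      subst₂ (λ a b → Walk P a b _) (start w) (trans (cong (at w) (m+[n∸m]≡n j≤ℓ)) (finish w))
        (subst (λ v → Walk P (at w 0) v i) same (slice w 0 i (≤-trans (<⇒≤ i<j) j≤ℓ))
          ++ʷ slice w j (ℓ ∸ j) (≤-reflexive (m+[n∸m]≡n j≤ℓ)))

    walk? : Decidable P → ∀ ℓ a b → Dec (Walk P a b ℓ)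
    walk? P? zero a b with P? a | a Fin.≟ b
    ... | yes pa | yes refl = yes (stay pa)
    ... | no ¬pa | _        = no λ w → ¬pa (first-inside w)
    ... | _      | no a≢b   = no λ w → a≢b (trans (sym (start w)) (finish w))
    walk? P? (suc ℓ) a b with P? a | Fin.any? (λ x → adj? G a x ×-dec walk? P? ℓ x b)
    ... | yes pa | yes (x , a~x , w) = yes (edge pa (first-inside w) a~x ++ʷ w)
    ... | no ¬pa | _                 = no λ w → ¬pa (first-inside w)
    ... | yes _  | no none           = no λ w → none (at w 1 , subst (_~ at w 1) (start w) (step w 0 (s≤s z≤n)) ,
                                              subst (λ y → Walk P (at w 1) y ℓ) (finish w) (slice w 1 ℓ ≤-refl))

  record Colouring (P : VertexSet) (m : ℕ) : Set where
    field
      colour  : V → ℕ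
      bounded : ∀ {x} → P x → colour x < m
      proper  : ∀ {x y} → P x → P y → x ~ y → colour x ≢ colour y

  open Colouring public

  module _ {P : VertexSet} where

    widen : ∀ {m m′} → m ≤ m′ → Colouring P m → Colouring P m′
    widen m≤m′ c = record { colour = colour c ; bounded = λ px → ≤-trans (bounded c px) m≤m′ ; proper = proper c }

    independent-colouring : (∀ {x y} → P x → P y → ¬ x ~ y) → Colouring P 1
    independent-colouring indep = record
      { colour = λ _ → 0 ; bounded = λ _ → s≤s z≤n ; proper = λ px py x~y _ → indep px py x~y }

    empty-colouring : (∀ {x} → ¬ P x) → Colouring P 0
    empty-colouring empty = record
      { colour = λ _ → 0 ; bounded = λ px → contradiction px empty ; proper = λ px → contradiction px empty }

    split : ∀ {Q : VertexSet} → Decidable Q → P ⊆ Q ∪ (P ∩ ∁ Q)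
    split Q? {x} px with Q? x
    ... | yes qx = inj₁ qx
    ... | no ¬qx = inj₂ (px , ¬qx)

    union-colouring : ∀ {Q R m k} → Decidable Q → P ⊆ Q ∪ R → Colouring Q m → Colouring R k → Colouring P (m + k)
    union-colouring {Q} {R} {m} {k} Q? P⊆Q∪R c d = record
      { colour = λ x → colour′ (Q? x) ; bounded = λ {x} px → bounded′ px (Q? x)
      ; proper = λ {x} {y} px py x~y → proper′ px py x~y (Q? x) (Q? y) }
      where
      colour′ : ∀ {x} → Dec (Q x) → ℕ
      colour′ {x} (yes _) = colour c x
      colour′ {x} (no  _) = m + colour d x

      in-R : ∀ {x} → P x → ¬ Q x → R x
      in-R px ¬qx with P⊆Q∪R px
      ... | inj₁ qx = contradiction qx ¬qx
      ... | inj₂ rx = rx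

      bounded′ : ∀ {x} → P x → (q? : Dec (Q x)) → colour′ q? < m + k
      bounded′ px (yes qx)  = ≤-trans (bounded c qx) (m≤m+n m k)
      bounded′ px (no  ¬qx) = +-monoʳ-< m (bounded d (in-R px ¬qx))

      proper′ : ∀ {x y} → P x → P y → x ~ y → (qx? : Dec (Q x)) (qy? : Dec (Q y)) → colour′ qx? ≢ colour′ qy?
      proper′ px py x~y (yes qx)  (yes qy)  = proper c qx qy x~y
      proper′ px py x~y (no  ¬qx) (no  ¬qy) = proper d (in-R px ¬qx) (in-R py ¬qy) x~y ∘ +-cancelˡ-≡ m _ _
      proper′ px py x~y (yes qx)  (no  _)   = <⇒≢ (≤-trans (bounded c qx) (m≤m+n m _))
      proper′ px py x~y (no  _)   (yes qy)  = ≢-sym (<⇒≢ (≤-trans (bounded c qy) (m≤m+n m _)))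

  ⋃-colouring : ∀ {I : Set} {P m} (Class : I → VertexSet) → (∀ i → Decidable (Class i)) → (is : List I) →
                (∀ {i} → i ∈ is → Colouring (Class i) m) → P ⊆ (λ x → ∃ λ i → i ∈ is × Class i x) →
                Colouring P (length is * m)
  ⋃-colouring Class Class? []       colour-class P⊆⋃ = empty-colouring λ px → case P⊆⋃ px of λ { (_ , () , _) }
  ⋃-colouring {P = P} Class Class? (i ∷ is) colour-class P⊆⋃ =
    union-colouring (Class? i) (split {P = P} (Class? i)) (colour-class (here refl))
      (⋃-colouring Class Class? is (colour-class ∘ there) rest)
    where
    rest : P ∩ ∁ (Class i) ⊆ (λ x → ∃ λ j → j ∈ is × Class j x)
    rest (px , ¬cx) with P⊆⋃ px
    ... | _ , here refl , cx = contradiction cx ¬cx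
    ... | j , there j∈is , cx = j , j∈is , cx

  colouring⇒Colorable : ∀ {m} → Colouring U m → Colorable G m
  colouring⇒Colorable c =
    (λ x → Fin.fromℕ< (bounded c {x} _)) ,
    λ x y x~y same → proper c _ _ x~y (trans (sym (Fin.toℕ-fromℕ< _)) (trans (cong toℕ same) (Fin.toℕ-fromℕ< _)))

  -- Two-colourings and odd closed walks

  OddClosedWalk : VertexSet → Set
  OddClosedWalk P = ∃₂ λ a ℓ → Walk P a a ℓ × parity ℓ ≡ 1ℙ

  module Components {P : VertexSet} (P? : Decidable P) where

    -- Walks shorter than n suffice (shorten), which makes connectivity decidable.
    Connected : V → V → Set
    Connected x y = Σ (Fin n) λ ℓ → Walk P x y (toℕ ℓ)

    hops : ∀ {x y} → Connected x y → ℕ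
    hops = toℕ ∘ proj₁

    connected? : ∀ x y → Dec (Connected x y)
    connected? x y = Fin.any? λ ℓ → walk? P? (toℕ ℓ) x y

    shorten : ∀ {x y ℓ} → Walk P x y ℓ → Connected x y
    shorten {x} {y} {ℓ} = <-rec (λ ℓ → Walk P x y ℓ → Connected x y) go ℓ
      where
      go : ∀ ℓ → (∀ {ℓ′} → ℓ′ < ℓ → Walk P x y ℓ′ → Connected x y) → Walk P x y ℓ → Connected x y
      go ℓ shorter w with ℓ <? n
      ... | yes ℓ<n = Fin.fromℕ< ℓ<n , subst (Walk P x y) (sym (Fin.toℕ-fromℕ< ℓ<n)) w
      ... | no  ℓ≮n with Fin.pigeonhole (s≤s (≮⇒≥ ℓ≮n)) (λ t → at w (toℕ t))
      ...   | i , j , i<j , same =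
        shorter (<-≤-trans (+-monoˡ-< (ℓ ∸ toℕ j) i<j) (≤-reflexive (m+[n∸m]≡n j≤ℓ)))
                (skip-loop w i<j j≤ℓ same)
        where
        j≤ℓ : toℕ j ≤ ℓ
        j≤ℓ = ≤-pred (Fin.toℕ<n j)

    connected-sym : ∀ {x y} → Connected x y → Connected y x
    connected-sym (ℓ , w) = ℓ , reverse w

    connected-trans : ∀ {x y z} → Connected x y → Connected y z → Connected x z
    connected-trans (_ , w) (_ , v) = shorten (w ++ʷ v)

    record Anchor (x : V) : Set where
      field
        root     : V
        to-root  : Connected x root
        earliest : ∀ {v} → Connected x v → toℕ root ≤ toℕ v
    open Anchor

    reaches? : ∀ x → Decidable (λ j → ∃ λ v → toℕ v ≡ j × Connected x v)
    reaches? x j = Fin.any? λ v → (toℕ v Data.Nat.≟ j) ×-dec connected? x v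

    anchor : ∀ {x} → P x → Anchor x
    anchor {x} px with least-witness (reaches? x) {toℕ x} (x , refl , shorten (stay px))
    ... | _ , (r , refl , x↝r) , below = record
      { root = r ; to-root = x↝r ; earliest = λ x↝v → ≮⇒≥ λ v<r → below v<r (_ , refl , x↝v) }

    root-unique : ∀ {x y} → Connected x y → (α : Anchor x) (β : Anchor y) → root α ≡ root β
    root-unique x↝y α β = Fin.toℕ-injective (≤-antisym
      (earliest α (connected-trans x↝y (to-root β)))
      (earliest β (connected-trans (connected-sym x↝y) (to-root α))))

    -- Colour a vertex by the parity of a walk to the least vertex of its component; adjacent
    -- vertices of equal colour close an odd walk through that common root.
    side : V → Parity
    side x with P? x
    ... | yes px = parity (hops (to-root (anchor px)))
    ... | no  _  = 0ℙ

    side-anchor : ∀ {x} → P x → Σ (Anchor x) λ α → side x ≡ parity (hops (to-root α))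
    side-anchor {x} px with P? x
    ... | yes px′ = anchor px′ , refl
    ... | no  ¬px = contradiction px ¬px

    same-side⇒odd-closed-walk : ∀ {x y} → P x → P y → x ~ y → side x ≡ side y → OddClosedWalk P
    same-side⇒odd-closed-walk {x} {y} px py x~y same
      with α , side-x ← side-anchor px | β , side-y ← side-anchor py
      with ℓ , x↝r ← to-root α | ℓ′ , y↝r′ ← to-root β =
        x , _ , edge px py x~y ++ʷ subst (λ r → Walk P y r (toℕ ℓ′)) (sym r≡r′) y↝r′ ++ʷ reverse x↝r ,
        same-parity⇒1+m+n-odd (toℕ ℓ′) (toℕ ℓ) (trans (sym side-y) (trans (sym same) side-x))
      where
      r≡r′ : root α ≡ root β
      r≡r′ = root-unique (shorten (edge px py x~y)) α β

    two-colouring-or-odd-closed-walk : Colouring P 2 ⊎ OddClosedWalk P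
    two-colouring-or-odd-closed-walk
      with Fin.any? (λ x → Fin.any? λ y → P? x ×-dec P? y ×-dec adj? G x y ×-dec (side x ℙ.≟ side y))
    ... | yes (x , y , px , py , x~y , same) = inj₂ (same-side⇒odd-closed-walk px py x~y same)
    ... | no none = inj₁ record
      { colour = bit ∘ side ; bounded = λ _ → bit<2 _
      ; proper = λ {x} {y} px py x~y same → none (x , y , px , py , x~y , bit-injective same) }

  open Components using (two-colouring-or-odd-closed-walk)

  -- Induced odd cycles and their packings

  record InducedOddCycle (P : VertexSet) : Set where
    field
      len       : ℕ
      vertex    : Fin (oddLen len) → V
      injective : Injective _≡_ _≡_ vertex
      adjacent  : ∀ i j → vertex i ~ vertex j ⇔ CycAdj i j
      within    : ∀ i → P (vertex i)

  open InducedOddCycle using (vertex; within)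

  cycle-mono : ∀ {P Q} → P ⊆ Q → InducedOddCycle P → InducedOddCycle Q
  cycle-mono P⊆Q O = record { InducedOddCycle O ; within = P⊆Q ∘ within O }

  ClosedNeighbourhood : ∀ {P} → InducedOddCycle P → VertexSet
  ClosedNeighbourhood O x = ∃ λ i → vertex O i ≡ x ⊎ vertex O i ~ x

  record Packing (P : VertexSet) (k : ℕ) : Set where
    field
      cycles       : Fin k → InducedOddCycle P
      disjoint     : ∀ {j j′} i i′ → j ≢ j′ → vertex (cycles j) i ≢ vertex (cycles j′) i′
      anticomplete : ∀ {j j′} i i′ → j ≢ j′ → ¬ vertex (cycles j) i ~ vertex (cycles j′) i′

  open Packing

  packing-mono : ∀ {P Q k} → P ⊆ Q → Packing P k → Packing Q k
  packing-mono P⊆Q 𝒫 = record { Packing 𝒫 ; cycles = cycle-mono P⊆Q ∘ cycles 𝒫 }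

  packing⇒HasIOCP : ∀ {P k} → Packing P k → HasIOCP G k
  packing⇒HasIOCP 𝒫 =
    InducedOddCycle.len ∘ cycles 𝒫 , vertex ∘ cycles 𝒫 , InducedOddCycle.injective ∘ cycles 𝒫 ,
    (λ j j′ i i′ → disjoint 𝒫 i i′) , InducedOddCycle.adjacent ∘ cycles 𝒫 , (λ j j′ i i′ → anticomplete 𝒫 i i′)

  extend : ∀ {P Q k} (O : InducedOddCycle P) → Q ⊆ P → Q ⊆ ∁ (ClosedNeighbourhood O) → Packing Q k → Packing P (suc k)
  extend {P} {Q} {k} O Q⊆P far 𝒫 = record { cycles = cycles′ ; disjoint = disjoint′ ; anticomplete = anticomplete′ }
    where
    cycles′ : Fin (suc k) → InducedOddCycle P
    cycles′ Fin.zero    = O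
    cycles′ (Fin.suc j) = cycle-mono Q⊆P (cycles 𝒫 j)

    disjoint′ : ∀ {j j′} i i′ → j ≢ j′ → vertex (cycles′ j) i ≢ vertex (cycles′ j′) i′
    disjoint′ {Fin.zero}  {Fin.zero}   i i′ j≢j′ = contradiction refl j≢j′
    disjoint′ {Fin.zero}  {Fin.suc j′} i i′ _ same = far (within (cycles 𝒫 j′) i′) (i , inj₁ same)
    disjoint′ {Fin.suc j} {Fin.zero}   i i′ _ same = far (within (cycles 𝒫 j) i) (i′ , inj₁ (sym same))
    disjoint′ {Fin.suc j} {Fin.suc j′} i i′ j≢j′ = disjoint 𝒫 i i′ (j≢j′ ∘ cong Fin.suc)

    anticomplete′ : ∀ {j j′} i i′ → j ≢ j′ → ¬ vertex (cycles′ j) i ~ vertex (cycles′ j′) i′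
    anticomplete′ {Fin.zero}  {Fin.zero}   i i′ j≢j′ = contradiction refl j≢j′
    anticomplete′ {Fin.zero}  {Fin.suc j′} i i′ _ adj = far (within (cycles 𝒫 j′) i′) (i , inj₂ adj)
    anticomplete′ {Fin.suc j} {Fin.zero}   i i′ _ adj = far (within (cycles 𝒫 j) i) (i′ , inj₂ (~-sym adj))
    anticomplete′ {Fin.suc j} {Fin.suc j′} i i′ j≢j′ = anticomplete 𝒫 i i′ (j≢j′ ∘ cong Fin.suc)

  singleton-packing : ∀ {P} → InducedOddCycle P → Packing P 1
  singleton-packing O = extend {Q = ∅} O (λ ()) (λ ()) record
    { cycles = λ () ; disjoint = λ {j} → case j of λ () ; anticomplete = λ {j} → case j of λ () }

  Clique : VertexSet → List V → Set
  Clique P K = AllPairs _~_ K × All P K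

  CliqueBound : VertexSet → ℕ → Set
  CliqueBound P w = ∀ {K} → Clique P K → length K ≤ w

  clique-bound-mono : ∀ {P Q w} → Q ⊆ P → CliqueBound P w → CliqueBound Q w
  clique-bound-mono Q⊆P bound (pairwise , inside) = bound (pairwise , All.map Q⊆P inside)

  clique? : ∀ {P} → Decidable P → ∀ s → Dec (∃ λ K → Clique P K × length K ≡ s)
  clique? P? zero = yes ([] , ([] , []) , refl)
  clique? P? (suc s) with Fin.any? (λ x → P? x ×-dec clique? (P? ∩? adj? G x) s)
  ... | yes (x , px , K , (pairwise , inside) , len) =
    yes (x ∷ K , (All.map proj₂ inside ∷ pairwise , px ∷ All.map proj₁ inside) , cong suc len)
  ... | no none = no λ where
    ([] , _ , ())
    (x ∷ K , (x~K ∷ pairwise , px ∷ inside) , len) →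
      none (x , px , K , (pairwise , All.zip (inside , x~K)) , suc-injective len)

  maximum-clique : ∀ {P w} → Decidable P → CliqueBound P w → ∃ λ K → Clique P K × CliqueBound P (length K)
  maximum-clique {P} {w} P? bound =
    maximum (least-witness (λ t → ¬? (clique? P? (suc t))) {w} (λ (_ , cl , len) → 1+n≰n (subst (_≤ w) len (bound cl))))
    where
    Sized : ℕ → Set
    Sized s = ∃ λ K → Clique P K × length K ≡ s

    clique-of-size : ∀ s → (∀ {j} → j < s → ¬ ¬ Sized (suc j)) → Sized s
    clique-of-size zero    _       = [] , ([] , []) , refl
    clique-of-size (suc j) smaller = decidable-stable (clique? P? (suc j)) (smaller (n<1+n j))

    maximal : ∀ {s} → ¬ Sized (suc s) → CliqueBound P s
    maximal {s} no-larger {K} (pairwise , inside) = ≮⇒≥ λ s<K → no-larger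
      (take (suc s) K , (AllPairs.take⁺ _ pairwise , All.take⁺ _ inside) , trans (length-take _ K) (m≤n⇒m⊓n≡m s<K))

    maximum : Least (λ s → ¬ Sized (suc s)) → ∃ λ K → Clique P K × CliqueBound P (length K)
    maximum (s , no-larger , smaller) with K , K-clique , refl ← clique-of-size s smaller =
      K , K-clique , maximal no-larger

  lookup-injective : ∀ {K} → AllPairs _~_ K → Injective _≡_ _≡_ (lookup K)
  lookup-injective pairwise {i} {j} same = decidable-stable (i Fin.≟ j) λ i≢j →
    irrefl G (subst (_~ _) same (AllPairs-lookup ~-sym pairwise i≢j))

  clique⇒HasClique : ∀ {P K} → Clique P K → HasClique G (length K)
  clique⇒HasClique {K = K} (pairwise , _) = lookup K , lookup-injective pairwise , λ i j → AllPairs-lookup ~-sym pairwise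

  triangle : ∀ {P a b c} → AllPairs _~_ (a ∷ b ∷ c ∷ []) → All P (a ∷ b ∷ c ∷ []) → InducedOddCycle P
  triangle {a = a} {b} {c} pairwise inside = record
    { len       = 0
    ; vertex    = corner
    ; injective = lookup-injective pairwise
    ; adjacent  = λ i j → mk⇔ (λ i~j → triangle-consecutive i j λ { refl → irrefl G i~j })
                               (λ i-j → AllPairs-lookup ~-sym pairwise {i} {j} λ { refl → CycAdj-irrefl (s≤s (s≤s z≤n)) i-j })
    ; within    = λ i → All.lookup inside (∈-lookup i) }
    where
    corner : Fin 3 → V
    corner = lookup (a ∷ b ∷ c ∷ [])

  -- Shortest odd closed walks

  TriangleFree : VertexSet → Set
  TriangleFree P = ∀ {x y z} → P x → P y → P z → x ~ y → y ~ z → x ~ z → ⊥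

  record ShortestOddClosedWalk (P : VertexSet) : Set where
    field
      L       : ℕ
      base    : V
      walk    : Walk P base base L
      odd     : parity L ≡ 1ℙ
      minimal : ∀ {b ℓ} → Walk P b b ℓ → parity ℓ ≡ 1ℙ → L ≤ ℓ

  shortest-odd-closed-walk : ∀ {P} → Decidable P → OddClosedWalk P → ShortestOddClosedWalk P
  shortest-odd-closed-walk {P} P? (a , ℓ , w , odd)
    with least-witness (λ ℓ → (parity ℓ ℙ.≟ 1ℙ) ×-dec Fin.any? (λ a → walk? P? ℓ a a)) {ℓ} (odd , a , w)
  ... | L , (odd , a , w) , below = record
    { L = L ; base = a ; walk = w ; odd = odd ; minimal = λ w′ odd′ → ≮⇒≥ λ ℓ<L → below ℓ<L (odd′ , _ , w′) }

  module Shortest {P : VertexSet} (S : ShortestOddClosedWalk P) where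
    open ShortestOddClosedWalk S public

    p : ℕ → V
    p = at walk

    p-L : p L ≡ p 0
    p-L = trans (finish walk) (sym (start walk))

    p-inside : ∀ {t} → t ≤ L → P (p t)
    p-inside = inside walk _

    i≤L : ∀ i d → i + d ≤ L → i ≤ L
    i≤L i d = ≤-trans (m≤m+n i d)

    complement : ∀ i d → i + d ≤ L → Walk P (p (i + d)) (p i) (L ∸ (i + d) + i)
    complement i d i+d≤L =
      subst (λ v → Walk P (p (i + d)) v _) (trans (cong p (m+[n∸m]≡n i+d≤L)) p-L)
        (slice walk (i + d) (L ∸ (i + d)) (≤-reflexive (m+[n∸m]≡n i+d≤L)))
      ++ʷ slice walk 0 i (i≤L i d i+d≤L)

    complement-length : ∀ i d → i + d ≤ L → L ∸ (i + d) + i ≡ L ∸ d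
    complement-length i d i+d≤L = begin
      L ∸ (i + d) + i   ≡⟨ cong (λ x → L ∸ x + i) (+-comm i d) ⟩
      L ∸ (d + i) + i   ≡⟨ cong (_+ i) (sym (∸-+-assoc L d i)) ⟩
      L ∸ d ∸ i + i     ≡⟨ m∸n+n≡m (m+n≤o⇒m≤o∸n i i+d≤L) ⟩
      L ∸ d             ∎
      where open ≡-Reasoning

    ≼-from-odd-closure : ∀ {a d d′ c} → d + d′ ≡ L → Walk P a a (d + c) → parity (d + c) ≡ 1ℙ → d′ ≼ c
    ≼-from-odd-closure {d = d} {d′} {c} d+d′≡L w odd-w =
      +-cancelˡ-≤ d d′ c (subst (_≤ d + c) (sym d+d′≡L) (minimal w odd-w)) ,
      odd-summands⇒same-parity d d′ c (trans (cong parity d+d′≡L) odd) odd-w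

    -- Closing the arc of length d and the complementary arc by the bypass gives two closed walks of
    -- total length L + 2c, so one of them is odd and therefore at least L long.
    bypass : ∀ {c} i d → i + d ≤ L → Walk P (p (i + d)) (p i) c → d ≼ c ⊎ ∃ λ d′ → d + d′ ≡ L × d′ ≼ c
    bypass {c} i d i+d≤L s =
      Sum.[ inj₂ ∘ shortcut-rest , inj₁ ∘ shortcut-arc ]′ (odd-summand (parity (d + c)) (parity (L ∸ d + c)) odd-total)
      where
      d+[L∸d]≡L : d + (L ∸ d) ≡ L
      d+[L∸d]≡L = m+[n∸m]≡n (≤-trans (m≤n+m d i) i+d≤L)

      odd-total : parity (d + c) ⊕ parity (L ∸ d + c) ≡ 1ℙ
      odd-total = trans (parity-+-cancel-middle d (L ∸ d) c) (trans (cong parity d+[L∸d]≡L) odd)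

      shortcut-rest : parity (d + c) ≡ 1ℙ → ∃ λ d′ → d + d′ ≡ L × d′ ≼ c
      shortcut-rest odd-arc = L ∸ d , d+[L∸d]≡L , ≼-from-odd-closure d+[L∸d]≡L (slice walk i d i+d≤L ++ʷ s) odd-arc

      shortcut-arc : parity (L ∸ d + c) ≡ 1ℙ → d ≼ c
      shortcut-arc odd-rest = ≼-from-odd-closure (trans (+-comm (L ∸ d) d) d+[L∸d]≡L)
        (subst (λ ℓ → Walk P (p (i + d)) (p (i + d)) (ℓ + c)) (complement-length i d i+d≤L)
           (complement i d i+d≤L ++ʷ reverse s)) odd-rest

    loop-free : ∀ i d → i + d ≤ L → p i ≡ p (i + d) → d ≡ 0 ⊎ d ≡ L
    loop-free i d i+d≤L same
      with bypass i d i+d≤L (subst (λ v → Walk P (p (i + d)) v 0) (sym same) (stay (p-inside i+d≤L)))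
    ... | inj₁ d≼0 = inj₁ (≼0 d≼0)
    ... | inj₂ (d′ , d+d′≡L , d′≼0) rewrite ≼0 d′≼0 = inj₂ (trans (sym (+-identityʳ d)) d+d′≡L)

    chord-free : ∀ i d → i + d ≤ L → p i ~ p (i + d) → d ≡ 1 ⊎ d + 1 ≡ L
    chord-free i d i+d≤L pi~pj with bypass i d i+d≤L (edge (p-inside i+d≤L) (p-inside (i≤L i d i+d≤L)) (~-sym pi~pj))
    ... | inj₁ d≼1 = inj₁ (≼1 d≼1)
    ... | inj₂ (d′ , d+d′≡L , d′≼1) rewrite ≼1 d′≼1 = inj₂ d+d′≡L

    common-neighbour : ∀ {u} i d → i + d ≤ L → P u → u ~ p i → u ~ p (i + d) → d ≡ 0 ⊎ d ≡ 2 ⊎ d + 2 ≡ L ⊎ d ≡ L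
    common-neighbour i d i+d≤L pu u~pi u~pj
      with bypass i d i+d≤L (edge (p-inside i+d≤L) pu (~-sym u~pj) ++ʷ edge pu (p-inside (i≤L i d i+d≤L)) u~pi)
    ... | inj₁ d≼2 = Sum.map₂ inj₁ (≼2 d≼2)
    ... | inj₂ (d′ , d+d′≡L , d′≼2) with ≼2 d′≼2
    ...   | inj₁ refl = inj₂ (inj₂ (inj₂ (trans (sym (+-identityʳ d)) d+d′≡L)))
    ...   | inj₂ refl = inj₂ (inj₂ (inj₁ d+d′≡L))

    adjacent-neighbours : ∀ {u v} i d → i + d ≤ L → P u → P v → u ~ v → u ~ p i → v ~ p (i + d) →
                          d ≡ 1 ⊎ d ≡ 3 ⊎ d + 1 ≡ L ⊎ d + 3 ≡ L
    adjacent-neighbours i d i+d≤L pu pv u~v u~pi v~pj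
      with bypass i d i+d≤L (edge (p-inside i+d≤L) pv (~-sym v~pj) ++ʷ edge pv pu (~-sym u~v)
                               ++ʷ edge pu (p-inside (i≤L i d i+d≤L)) u~pi)
    ... | inj₁ d≼3 = Sum.map₂ inj₁ (≼3 d≼3)
    ... | inj₂ (d′ , d+d′≡L , d′≼3) with ≼3 d′≼3
    ...   | inj₁ refl = inj₂ (inj₂ (inj₁ d+d′≡L))
    ...   | inj₂ refl = inj₂ (inj₂ (inj₂ d+d′≡L))

    p-injective-< : ∀ {i j} → i < j → j < L → p i ≢ p j
    p-injective-< {i} i<j j<L same with d , refl ← m≤n⇒∃[o]m+o≡n (<⇒≤ i<j) with loop-free i d (<⇒≤ j<L) same
    ... | inj₁ refl = <-irrefl (sym (+-identityʳ i)) i<j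
    ... | inj₂ refl = <⇒≱ j<L (m≤n+m L i)

    adjacent⇒consecutive : ∀ {i j} → i < j → j < L → p i ~ p j → suc i ≡ j ⊎ (suc j ≡ L × i ≡ 0)
    adjacent⇒consecutive {i} i<j j<L pi~pj with d , refl ← m≤n⇒∃[o]m+o≡n (<⇒≤ i<j) with chord-free i d (<⇒≤ j<L) pi~pj
    ... | inj₁ refl = inj₁ (+-comm 1 i)
    ... | inj₂ d+1≡L = inj₂ (trans (cong suc i+d≡d) (trans (+-comm 1 d) d+1≡L) , i≡0)
      where
      i≡0 : i ≡ 0
      i≡0 = n≤0⇒n≡0 (+-cancelʳ-≤ d i 0 (≤-pred (subst (i + d <_) (sym (trans (+-comm 1 d) d+1≡L)) j<L)))
      i+d≡d : i + d ≡ d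
      i+d≡d = cong (_+ d) i≡0

    consecutive⇒adjacent : ∀ {i j} → i < L → suc i ≡ j ⊎ (suc i ≡ L × j ≡ 0) → p i ~ p j
    consecutive⇒adjacent {i} i<L (inj₁ refl)        = step walk i i<L
    consecutive⇒adjacent {i} i<L (inj₂ (1+i≡L , refl)) = subst (p i ~_) (trans (cong p 1+i≡L) p-L) (step walk i i<L)

    L≢1 : L ≢ 1
    L≢1 L≡1 = irrefl G (subst (p 0 ~_) (trans (cong p (sym L≡1)) p-L) (step walk 0 (subst (0 <_) (sym L≡1) (s≤s z≤n))))

    m : ℕ
    m = proj₁ (odd⇒oddLen L odd L≢1)

    L≡oddLen : L ≡ oddLen m
    L≡oddLen = proj₂ (odd⇒oddLen L odd L≢1)

    index<L : (i : Fin (oddLen m)) → toℕ i < L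
    index<L i = subst (toℕ i <_) (sym L≡oddLen) (Fin.toℕ<n i)

    cycle : InducedOddCycle P
    cycle = record
      { len = m ; vertex = corner ; injective = injective
      ; adjacent = λ i j → mk⇔ (adjacent→ i j) (adjacent← i j)
      ; within = λ i → p-inside (<⇒≤ (index<L i)) }
      where
      corner : Fin (oddLen m) → V
      corner i = p (toℕ i)

      injective : Injective _≡_ _≡_ corner
      injective {i} {j} same with Fin.<-cmp i j
      ... | tri< i<j _ _ = contradiction same (p-injective-< i<j (index<L j))
      ... | tri≈ _ i≡j _ = i≡j
      ... | tri> _ _ j<i = contradiction (sym same) (p-injective-< j<i (index<L i))

      forward : ∀ {i j : Fin (oddLen m)} → toℕ i < toℕ j → corner i ~ corner j → CycAdj i j
      forward {i} {j} i<j vi~vj with adjacent⇒consecutive i<j (index<L j) vi~vj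
      ... | inj₁ next          = inj₁ (inj₁ next)
      ... | inj₂ (1+j≡L , i≡0) = inj₂ (inj₂ (trans 1+j≡L L≡oddLen , i≡0))

      adjacent→ : ∀ i j → corner i ~ corner j → CycAdj i j
      adjacent→ i j vi~vj with Fin.<-cmp i j
      ... | tri< i<j _ _    = forward i<j vi~vj
      ... | tri≈ _ refl _   = contradiction vi~vj (irrefl G)
      ... | tri> _ _ j<i    = Sum.swap (forward j<i (~-sym vi~vj))

      next→ : ∀ i j → CycNext i j → corner i ~ corner j
      next→ i j (inj₁ next)          = consecutive⇒adjacent (index<L i) (inj₁ next)
      next→ i j (inj₂ (1+i≡L , j≡0)) = consecutive⇒adjacent (index<L i) (inj₂ (trans 1+i≡L (sym L≡oddLen) , j≡0))

      adjacent← : ∀ i j → CycAdj i j → corner i ~ corner j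
      adjacent← i j (inj₁ i→j) = next→ i j i→j
      adjacent← i j (inj₂ j→i) = ~-sym (next→ j i j→i)

    OnWalk : VertexSet
    OnWalk x = ∃ λ i → i < L × p i ≡ x

    Touches : VertexSet
    Touches x = ∃ λ i → i < L × x ~ p i

    Near : VertexSet
    Near = P ∩ (OnWalk ∪ Touches)

    on-or-touches? : Decidable (OnWalk ∪ Touches)
    on-or-touches? = (λ x → anyUpTo? (λ i → p i Fin.≟ x) L) ∪? (λ x → anyUpTo? (λ i → adj? G x (p i)) L)

    near? : Decidable P → Decidable Near
    near? P? = P? ∩? on-or-touches?

    far-from-cycle : P ∩ ∁ Near ⊆ ∁ (ClosedNeighbourhood cycle)
    far-from-cycle (px , ¬near) (i , inj₁ same) = ¬near (px , inj₁ (toℕ i , index<L i , same))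
    far-from-cycle (px , ¬near) (i , inj₂ adj)  = ¬near (px , inj₂ (toℕ i , index<L i , ~-sym adj))

    module _ (5≤L : 5 ≤ L) where

      3≤L : 3 ≤ L
      3≤L = ≤-trans (s≤s (s≤s (s≤s z≤n))) 5≤L

      -- A vertex at position t of the walk is shaded by the hue of position t − 1, any other vertex by
      -- that of its first neighbour on the walk; the bypass lemmas make every edge join two positions an
      -- odd distance apart or reaching into the last three (Gap), and such positions differ in hue.
      hue : ℕ → ℕ
      hue t with t <? L ∸ 3
      ... | yes _ = bit (parity t)
      ... | no  _ = 2 + (t ∸ (L ∸ 3))

      hue<5 : ∀ {t} → t < L → hue t < 5
      hue<5 {t} t<L with t <? L ∸ 3
      ... | yes _   = ≤-trans (bit<2 (parity t)) (s≤s (s≤s z≤n))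
      ... | no  _ = s≤s (s≤s (m<n+o⇒m∸n<o t (L ∸ 3) (subst (t <_) (sym (m∸n+n≡m 3≤L)) t<L)))

      Gap : ℕ → Set
      Gap d = parity d ≡ 1ℙ ⊎ L ∸ 3 ≤ d

      hue-apart : ∀ i d → 0 < d → Gap d → hue i ≢ hue (i + d)
      hue-apart i d 0<d gap with i <? L ∸ 3 | i + d <? L ∸ 3
      ... | yes _ | yes i+d< with gap
      ...   | inj₁ odd-d = ℙ.p≢p⁻¹ (parity i) ∘ flip-parity ∘ bit-injective
        where
        flip-parity : parity i ≡ parity (i + d) → parity i ≡ parity i ⁻¹
        flip-parity same = trans same (trans (ℙ.+-homo-+ i d) (trans (cong (parity i ⊕_) odd-d) (ℙ.+-comm (parity i) 1ℙ)))
      ...   | inj₂ late = contradiction (≤-trans late (m≤n+m d i)) (<⇒≱ i+d<)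
      hue-apart i d 0<d gap | yes _ | no _ = <⇒≢ (≤-trans (bit<2 (parity i)) (m≤m+n 2 _))
      hue-apart i d 0<d gap | no i≮ | yes i+d< = contradiction (≤-<-trans (m≤m+n i d) i+d<) i≮
      hue-apart i d 0<d gap | no i≮ | no _ = λ same → <⇒≢ 0<d (+-cancelˡ-≡ (i ∸ (L ∸ 3)) 0 d
        (trans (+-identityʳ _) (trans (+-cancelˡ-≡ 2 _ _ same) (+-∸-comm d (≮⇒≥ i≮)))))

      before : ℕ → ℕ
      before zero    = L ∸ 1
      before (suc t) = t

      hue-before : ∀ t → hue (before t) ≢ hue t
      hue-before zero    = ≢-sym (hue-apart 0 (L ∸ 1) (m<n⇒0<n∸m (≤-trans (s≤s (s≤s z≤n)) 3≤L)) (inj₂ (∸-monoʳ-≤ L (s≤s z≤n))))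
      hue-before (suc t) = subst (λ s → hue t ≢ hue s) (+-comm t 1) (hue-apart t 1 (s≤s z≤n) (inj₁ refl))

      0<L∸3 : 0 < L ∸ 3
      0<L∸3 = ≤-trans (s≤s z≤n) (∸-monoˡ-≤ 3 5≤L)

      late-gap : ∀ {d c} → d + c ≡ L → c ≤ 3 → 0 < d × Gap d
      late-gap {d} {c} d+c≡L c≤3 = ≤-trans 0<L∸3 L∸3≤d , inj₂ L∸3≤d
        where
        L∸3≤d : L ∸ 3 ≤ d
        L∸3≤d = ≤-trans (∸-monoʳ-≤ L c≤3) (≤-reflexive (trans (cong (_∸ c) (sym d+c≡L)) (m+n∸n≡m d c)))

      data Location (x : V) : Set where
        on  : ∀ t → t < L → p t ≡ x → Location x
        off : ∀ a → a < L → x ~ p a → (∀ {b} → b < a → ¬ x ~ p b) → Location x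

      locate : ∀ {x} → (OnWalk ∪ Touches) x → Location x
      locate (inj₁ (t , t<L , pt≡x)) = on t t<L pt≡x
      locate {x} (inj₂ (a , a<L , x~pa)) with b , x~pb , below ← least-witness (λ i → adj? G x (p i)) x~pa =
        off b (≤-<-trans (≮⇒≥ λ a<b → below a<b x~pa) a<L) x~pb below

      shade : ∀ {x} → Location x → ℕ
      shade (on t _ _)    = hue (before t)
      shade (off a _ _ _) = hue a

      shade<5 : ∀ {x} (l : Location x) → shade l < 5
      shade<5 (on zero _ _)      = hue<5 (∸-monoʳ-< {L} {1} {0} (s≤s z≤n) (≤-trans (s≤s z≤n) 3≤L))
      shade<5 (on (suc t) t<L _) = hue<5 (<-trans (n<1+n t) t<L)
      shade<5 (off a a<L _ _)    = hue<5 a<L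

      on-on : ∀ {t t′} → t < t′ → t′ < L → p t ~ p t′ → hue (before t) ≢ hue (before t′)
      on-on {t} {t′} t<t′ t′<L pt~pt′ with adjacent⇒consecutive t<t′ t′<L pt~pt′
      ... | inj₁ refl             = hue-before t
      ... | inj₂ (1+t′≡L , refl) = λ same → hue-before t′ (trans (sym same) (cong (hue ∘ (_∸ 1)) (sym 1+t′≡L)))

      before-opposite : ∀ a d → d + 2 ≡ L → hue (before (a + d)) ≢ hue a
      before-opposite a zero    2≡L  = contradiction (≤-trans 5≤L (≤-reflexive (sym 2≡L))) λ { (s≤s (s≤s ())) }
      before-opposite a (suc d) d+3≡L with 0<d , gap ← late-gap {d} {3} (trans (+-suc d 2) d+3≡L) ≤-refl =
        subst (λ s → hue s ≢ hue a) (sym (cong before (+-suc a d))) (≢-sym (hue-apart a d 0<d gap))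

      on-off : ∀ {y t a} → P y → t < L → y ~ p t → y ~ p a → (∀ {b} → b < a → ¬ y ~ p b) → hue (before t) ≢ hue a
      on-off {a = a} py t<L y~pt y~pa below with d , refl ← m≤n⇒∃[o]m+o≡n (≮⇒≥ λ t<a → below t<a y~pt)
        with common-neighbour a d (<⇒≤ t<L) py y~pa y~pt
      ... | inj₁ refl               = subst (λ s → hue (before s) ≢ hue a) (sym (+-identityʳ a)) (hue-before a)
      ... | inj₂ (inj₁ refl)        = subst (λ s → hue (before s) ≢ hue a) (sym (+-suc a 1))
                                        (≢-sym (hue-apart a 1 (s≤s z≤n) (inj₁ refl)))
      ... | inj₂ (inj₂ (inj₁ d+2≡L)) = before-opposite a d d+2≡L
      ... | inj₂ (inj₂ (inj₂ refl)) = contradiction (m≤n+m L a) (<⇒≱ t<L)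

      off-off : ∀ {x y a b} → P x → P y → x ~ y → a ≤ b → b < L → x ~ p a → y ~ p b → hue a ≢ hue b
      off-off {a = a} px py x~y a≤b b<L x~pa y~pb with d , refl ← m≤n⇒∃[o]m+o≡n a≤b
        with adjacent-neighbours a d (<⇒≤ b<L) px py x~y x~pa y~pb
      ... | inj₁ refl                = hue-apart a 1 (s≤s z≤n) (inj₁ refl)
      ... | inj₂ (inj₁ refl)         = hue-apart a 3 (s≤s z≤n) (inj₁ refl)
      ... | inj₂ (inj₂ (inj₁ d+1≡L)) = uncurry (hue-apart a d) (late-gap d+1≡L (s≤s z≤n))
      ... | inj₂ (inj₂ (inj₂ d+3≡L)) = uncurry (hue-apart a d) (late-gap d+3≡L ≤-refl)

      shade-proper : ∀ {x y} → P x → P y → x ~ y → (l : Location x) (l′ : Location y) → shade l ≢ shade l′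
      shade-proper px py x~y (on t t<L refl) (on t′ t′<L refl) with <-cmp t t′
      ... | tri< t<t′ _ _ = on-on t<t′ t′<L x~y
      ... | tri≈ _ refl _ = contradiction x~y (irrefl G)
      ... | tri> _ _ t′<t = ≢-sym (on-on t′<t t<L (~-sym x~y))
      shade-proper px py x~y (on t t<L refl) (off a _ y~pa below) = on-off py t<L (~-sym x~y) y~pa below
      shade-proper px py x~y (off a _ x~pa below) (on t t<L refl) = ≢-sym (on-off px t<L x~y x~pa below)
      shade-proper px py x~y (off a a<L x~pa _) (off b b<L y~pb _) with ≤-total a b
      ... | inj₁ a≤b = off-off px py x~y a≤b b<L x~pa y~pb
      ... | inj₂ b≤a = ≢-sym (off-off py px (~-sym x~y) b≤a a<L y~pb x~pa)

      near-colouring : Colouring Near 5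
      near-colouring = record
        { colour  = λ x → shade-of (on-or-touches? x)
        ; bounded = λ {x} near → bounded′ near (on-or-touches? x)
        ; proper  = λ {x} {y} near-x near-y x~y → proper′ near-x near-y x~y (on-or-touches? x) (on-or-touches? y) }
        where
        shade-of : ∀ {x} → Dec ((OnWalk ∪ Touches) x) → ℕ
        shade-of (yes l) = shade (locate l)
        shade-of (no  _) = 0

        bounded′ : ∀ {x} → Near x → (l? : Dec ((OnWalk ∪ Touches) x)) → shade-of l? < 5
        bounded′ _          (yes l) = shade<5 (locate l)
        bounded′ (_ , near) (no ¬l) = contradiction near ¬l

        proper′ : ∀ {x y} → Near x → Near y → x ~ y →
                  (l? : Dec ((OnWalk ∪ Touches) x)) (l′? : Dec ((OnWalk ∪ Touches) y)) → shade-of l? ≢ shade-of l′?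
        proper′ (px , _)    (py , _)    x~y (yes l)  (yes l′) = shade-proper px py x~y (locate l) (locate l′)
        proper′ (_ , near)  _           _   (no ¬l)  _        = contradiction near ¬l
        proper′ _           (_ , near)  _   (yes _)  (no ¬l′) = contradiction near ¬l′

    triangle-free⇒5≤L : TriangleFree P → 5 ≤ L
    triangle-free⇒5≤L no-triangle with m | L≡oddLen
    ... | suc m′ | L≡3+2m = subst (5 ≤_) (sym L≡3+2m) (+-monoʳ-≤ 3 (*-monoʳ-≤ 2 (s≤s z≤n)))
    ... | zero   | refl   = ⊥-elim (no-triangle (p-inside z≤n) (p-inside (s≤s z≤n)) (p-inside (s≤s (s≤s z≤n)))
                              (step walk 0 (s≤s z≤n)) (step walk 1 (s≤s (s≤s z≤n)))
                              (~-sym (subst (p 2 ~_) p-L (step walk 2 ≤-refl))))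

  no-odd-cycle⇒two-colouring : ∀ {P} → Decidable P → ¬ Packing P 1 → Colouring P 2
  no-odd-cycle⇒two-colouring P? no-cycle with two-colouring-or-odd-closed-walk P?
  ... | inj₁ two      = two
  ... | inj₂ odd-walk = contradiction (singleton-packing (cycle (shortest-odd-closed-walk P? odd-walk))) no-cycle
    where open Shortest using (cycle)

  triangle-free-colouring : ∀ k {P} → Decidable P → TriangleFree P → ¬ Packing P (suc k) → Colouring P (2 + 5 * k)
  triangle-free-colouring zero    P? _           no-packing = no-odd-cycle⇒two-colouring P? no-packing
  triangle-free-colouring (suc k) {P} P? no-triangle no-packing with two-colouring-or-odd-closed-walk P?
  ... | inj₁ two      = widen (m≤m+n 2 (5 * suc k)) two
  ... | inj₂ odd-walk = widen (≤-reflexive (cong (2 +_) (sym (*-suc 5 k))))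
                          (union-colouring (near? P?) (split {P = P} (near? P?))
                                           (near-colouring (triangle-free⇒5≤L no-triangle)) rest)
    where
    open Shortest (shortest-odd-closed-walk P? odd-walk)

    rest : Colouring (P ∩ ∁ Near) (2 + 5 * k)
    rest = triangle-free-colouring k (P? ∩? ∁? (near? P?)) (λ px py pz → no-triangle (proj₁ px) (proj₁ py) (proj₁ pz))
             (no-packing ∘ extend cycle proj₁ far-from-cycle)

  module CliqueDecomposition {P : VertexSet} (P? : Decidable P) {K : List V}
                             (K-clique : Clique P K) (K-maximum : CliqueBound P (length K)) where

    non-neighbours : V → List V
    non-neighbours x = filter (λ y → ¬? (adj? G x y)) K

    ∈-non-neighbours⁺ : ∀ {x z} → z ∈ K → ¬ x ~ z → z ∈ non-neighbours x
    ∈-non-neighbours⁺ {x} = ∈-filter⁺ (λ y → ¬? (adj? G x y))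

    ∈-non-neighbours⁻ : ∀ {x z} → z ∈ non-neighbours x → ¬ x ~ z
    ∈-non-neighbours⁻ {x} = proj₂ ∘ ∈-filter⁻ (λ y → ¬? (adj? G x y)) {xs = K}

    non-neighbours-nonempty : ∀ {x} → P x → length (non-neighbours x) ≢ 0
    non-neighbours-nonempty {x} px none = 1+n≰n (K-maximum (All.tabulate x~ ∷ proj₁ K-clique , px ∷ proj₂ K-clique))
      where
      x~ : ∀ {z} → z ∈ K → x ~ z
      x~ {z} z∈K with adj? G x z
      ... | yes x~z = x~z
      ... | no ¬x~z = contradiction none (≢-sym (<⇒≢ (∈-length (∈-non-neighbours⁺ z∈K ¬x~z))))

    twins-clique-bound : ∀ {Y N} → Clique P Y → All (λ y → non-neighbours y ≡ N) Y → length Y ≤ length N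
    twins-clique-bound {[]}          _                   _    = z≤n
    twins-clique-bound {Y@(y₀ ∷ _)} {N} (pairwise , inside) same = +-cancelʳ-≤ (length Z) (length Y) (length N) (begin
      length Y + length Z                ≡⟨ length-++ Y ⟨
      length (Y ++ Z)                    ≤⟨ K-maximum larger ⟩
      length K                           ≡⟨ length-filter-∁ (adj? G y₀) K ⟨
      length Z + length (non-neighbours y₀) ≡⟨ cong (λ N₀ → length Z + length N₀) (All.lookup same (here refl)) ⟩
      length Z + length N                ≡⟨ +-comm (length Z) (length N) ⟩
      length N + length Z                ∎)
      where
      open ≤-Reasoning
      Z : List V
      Z = filter (adj? G y₀) K

      cross : ∀ {y z} → y ∈ Y → z ∈ Z → y ~ z
      cross {y} {z} y∈Y z∈Z with ∈-filter⁻ (adj? G y₀) {xs = K} z∈Z | adj? G y z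
      ... | _   , y₀~z | yes y~z = y~z
      ... | z∈K , y₀~z | no ¬y~z =
        contradiction y₀~z (∈-non-neighbours⁻ (subst (z ∈_) same-as-y₀ (∈-non-neighbours⁺ z∈K ¬y~z)))
        where
        same-as-y₀ : non-neighbours y ≡ non-neighbours y₀
        same-as-y₀ = trans (All.lookup same y∈Y) (sym (All.lookup same (here refl)))

      larger : Clique P (Y ++ Z)
      larger = AllPairs.++⁺ pairwise (AllPairs.filter⁺ (adj? G y₀) (proj₁ K-clique))
                                     (All.tabulate λ y∈Y → All.tabulate (cross y∈Y)) ,
               All.++⁺ inside (All-resp-⊆ (filter-⊆ (adj? G y₀) K) (proj₂ K-clique))

    Twins : List V → VertexSet
    Twins N x = P x × non-neighbours x ≡ N

    twins? : ∀ N → Decidable (Twins N)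
    twins? N x = P? x ×-dec ≡-dec Fin._≟_ (non-neighbours x) N

    Triple : List V → VertexSet
    Triple T x = P x × take 3 (non-neighbours x) ≡ T

    triple? : ∀ T → Decidable (Triple T)
    triple? T x = P? x ×-dec ≡-dec Fin._≟_ (take 3 (non-neighbours x)) T

    twins-independent : ∀ {N} → length N ≡ 1 → ∀ {x y} → Twins N x → Twins N y → ¬ x ~ y
    twins-independent |N|≡1 (px , x-N) (py , y-N) x~y =
      1+n≰n (subst (2 ≤_) |N|≡1 (twins-clique-bound ((x~y ∷ []) ∷ [] ∷ [] , px ∷ py ∷ []) (x-N ∷ y-N ∷ [])))

    twins-triangle-free : ∀ {N} → length N ≡ 2 → TriangleFree (Twins N)
    twins-triangle-free |N|≡2 (px , x-N) (py , y-N) (pz , z-N) x~y y~z x~z =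
      1+n≰n (subst (3 ≤_) |N|≡2 (twins-clique-bound ((x~y ∷ x~z ∷ []) ∷ (y~z ∷ []) ∷ [] ∷ [] , px ∷ py ∷ pz ∷ [])
                                                     (x-N ∷ y-N ∷ z-N ∷ [])))

    triple-non-adjacent : ∀ {T x y} → Triple T x → y ∈ T → ¬ x ~ y
    triple-non-adjacent (_ , take≡T) y∈T = ∈-non-neighbours⁻ (Any-resp-⊆ (take-⊆ 3 _) (subst (_ ∈_) (sym take≡T) y∈T))

    triple-packing : ∀ {T k} → T ⊆ₗ K → length T ≡ 3 → Packing (Triple T) k → Packing P (suc k)
    triple-packing {a ∷ b ∷ c ∷ []} T⊆K refl = extend Δ proj₁ far
      where
      pairwise : AllPairs _~_ (a ∷ b ∷ c ∷ [])
      pairwise = AllPairs-resp-⊆ₗ T⊆K (proj₁ K-clique)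

      Δ : InducedOddCycle P
      Δ = triangle pairwise (All-resp-⊆ T⊆K (proj₂ K-clique))

      far : Triple (a ∷ b ∷ c ∷ []) ⊆ ∁ (ClosedNeighbourhood Δ)
      far tx (i , inj₂ vi~x)            = triple-non-adjacent tx (∈-lookup i) (~-sym vi~x)
      far tx (Fin.zero , inj₁ refl)     = triple-non-adjacent tx (∈-lookup (Fin.suc Fin.zero))
                                            (AllPairs-lookup ~-sym pairwise {Fin.zero} {Fin.suc Fin.zero} λ ())
      far tx (Fin.suc i , inj₁ refl)    = triple-non-adjacent tx (∈-lookup Fin.zero)
                                            (AllPairs-lookup ~-sym pairwise {Fin.suc i} {Fin.zero} λ ())

    Sparse : ℕ → VertexSet
    Sparse r x = P x × length (non-neighbours x) ≡ r

    sparse? : ∀ r → Decidable (Sparse r)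
    sparse? r x = P? x ×-dec (length (non-neighbours x) Data.Nat.≟ r)

    Dense : VertexSet
    Dense x = P x × 3 ≤ length (non-neighbours x)

    cover : P ⊆ Sparse 1 ∪ (Sparse 2 ∪ Dense)
    cover {x} px with length (non-neighbours x) in |N|
    ... | 0                 = contradiction |N| (non-neighbours-nonempty px)
    ... | 1                 = inj₁ (px , refl)
    ... | 2                 = inj₂ (inj₁ (px , refl))
    ... | suc (suc (suc _)) = inj₂ (inj₂ (px , s≤s (s≤s (s≤s z≤n))))

    sparse-cover : ∀ r → Sparse r ⊆ (λ x → ∃ λ N → N ∈ choose r K × Twins N x)
    sparse-cover r {x} (px , |N|) =
      non-neighbours x , subst (λ r → non-neighbours x ∈ choose r K) |N| (∈-choose⁺ (filter-⊆ _ K)) , px , refl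

    dense-cover : Dense ⊆ (λ x → ∃ λ T → T ∈ choose 3 K × Triple T x)
    dense-cover {x} (px , 3≤|N|) =
      take 3 (non-neighbours x) ,
      subst (λ r → take 3 (non-neighbours x) ∈ choose r K) (trans (length-take 3 (non-neighbours x)) (m≤n⇒m⊓n≡m 3≤|N|))
        (∈-choose⁺ (⊆-trans (take-⊆ 3 (non-neighbours x)) (filter-⊆ _ K))) ,
      px , refl

    colouring-from-classes : ∀ {a b} → (∀ {N} → N ∈ choose 2 K → Colouring (Twins N) a) →
                             (∀ {T} → T ∈ choose 3 K → Colouring (Triple T) b) →
                             Colouring P (length (choose 1 K) * 1 + (length (choose 2 K) * a + length (choose 3 K) * b))
    colouring-from-classes colour-pair colour-triple =
      union-colouring (sparse? 1) cover
        (⋃-colouring Twins twins? (choose 1 K)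
                     (λ N∈ → independent-colouring (twins-independent (proj₂ (∈-choose⁻ 1 K N∈)))) (sparse-cover 1))
        (union-colouring (sparse? 2) id
          (⋃-colouring Twins twins? (choose 2 K) colour-pair (sparse-cover 2))
          (⋃-colouring Triple triple? (choose 3 K) colour-triple dense-cover))

  colouring-bound : ∀ {w} k {P} → Decidable P → ¬ Packing P (suc k) → CliqueBound P w → Colouring P (f k w)
  colouring-bound zero    P? no-packing _ = no-odd-cycle⇒two-colouring P? no-packing
  colouring-bound {w} (suc k) {P} P? no-packing bound = from-maximum-clique (maximum-clique P? bound)
    where
    from-maximum-clique : (∃ λ K → Clique P K × CliqueBound P (length K)) → Colouring P (f (suc k) w)
    from-maximum-clique (K , K-clique , K-maximum) =
      widen (choose-count K (2 + 5 * suc k) (f k w) (bound K-clique)) (colouring-from-classes colour-pair colour-triple)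
      where
      open CliqueDecomposition P? K-clique K-maximum

      colour-pair : ∀ {N} → N ∈ choose 2 K → Colouring (Twins N) (2 + 5 * suc k)
      colour-pair {N} N∈ = triangle-free-colouring (suc k) (twins? N) (twins-triangle-free (proj₂ (∈-choose⁻ 2 K N∈)))
                             (no-packing ∘ packing-mono proj₁)

      colour-triple : ∀ {T} → T ∈ choose 3 K → Colouring (Triple T) (f k w)
      colour-triple {T} T∈ = colouring-bound k (triple? T) (no-packing ∘ uncurry triple-packing (∈-choose⁻ 3 K T∈))
                               (clique-bound-mono proj₁ bound)

theorem7 : (n : ℕ) (G : Graph (suc n)) (k w : ℕ) →
    IsIOCP G k → IsCliqueNumber G w → Colorable G (f k w)
theorem7 n G k w (_ , k-maximum) (_ , w-maximum) =
  colouring⇒Colorable G (colouring-bound G k U? no-packing (λ cl → w-maximum _ (clique⇒HasClique G cl)))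
  where
  no-packing : ¬ Packing G U (suc k)
  no-packing 𝒫 = 1+n≰n (k-maximum (suc k) (packing⇒HasIOCP G 𝒫))
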